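{- Let $(M,d_M),(N,d_N)$ be $\mathbf{V}$-continuity spaces and $f:M\times N\to\mathbf{V}$ uniformly continuous with modulus of uniform continuity $\Delta:\mathbf{V}^+\to\mathbf{V}^+$. Then $\Delta$ is also a modulus of uniform continuity for $\bigvee_f:M\to\mathbf{V}$, $x\mapsto\bigvee_{y\in N}f(x,y)$, and for $\bigwedge_f:M\to\mathbf{V}$, $x\mapsto\bigwedge_{y\in N}f(x,y)$.
   Context: $\mathbf{V}$ is a value co-quantale with $a\mathbin{\dot{ - }} b:=\bigwedge\{r: r+b\ge a\}$ and $\mathbf{V}^+=\{\epsilon:0\prec\epsilon\}$; $\mathbf{V}$ carries the symmetric distance $d_V(p,q)=(p\mathbin{\dot{ - }} q)\vee(q\mathbin{\dot{ - }} p)$. A $\mathbf{V}$-continuity space $(X,d)$ has $d:X\times X\to\mathbf{V}$ with $d(x,x)=0$ and $d(x,y)\le d(x,z)+d(z,y)$. $M\times N$ carries $d((x_1,y_1),(x_2,y_2))=d_M(x_1,x_2)\vee d_N(y_1,y_2)$. $\Delta$ is a modulus of uniform continuity for $g$ if $d(x,y)\le\Delta(\epsilon)$ implies $d(g(x),g(y))\le\epsilon$ for all $\epsilon\in\mathbf{V}^+$. -}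

module Defs where

open import Level using (Level; suc; _⊔_; Lift; lift)
open import Data.Bool using (Bool; true; false; if_then_else_)
open import Data.Empty using (⊥)
open import Data.Product using (Σ; ∃; _×_; _,_; proj₁; proj₂)
open import Function.Bundles using (_⇔_)
open import Relation.Binary.PropositionalEquality using (_≡_; subst; subst₂; sym)

record ValueCoQuantale (ℓ : Level) : Set (suc ℓ) where
  infix  4 _≤_ _≺_
  infixl 6 _+_
  field
    Carrier   : Set ℓ
    _≤_       : Carrier → Carrier → Set ℓ
    ≤-refl    : ∀ {a} → a ≤ a
    ≤-trans   : ∀ {a b c} → a ≤ b → b ≤ c → a ≤ c
    ≤-antisym : ∀ {a b} → a ≤ b → b ≤ a → a ≡ b
    ⋀         : {I : Set ℓ} → (I → Carrier) → Carrier
    ⋀-lb      : ∀ {I : Set ℓ} (f : I → Carrier) (i : I) → ⋀ f ≤ f i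
    ⋀-glb     : ∀ {I : Set ℓ} (f : I → Carrier) (a : Carrier) → (∀ i → a ≤ f i) → a ≤ ⋀ f
    ⋁         : {I : Set ℓ} → (I → Carrier) → Carrier
    ⋁-ub      : ∀ {I : Set ℓ} (f : I → Carrier) (i : I) → f i ≤ ⋁ f
    ⋁-lub     : ∀ {I : Set ℓ} (f : I → Carrier) (a : Carrier) → (∀ i → f i ≤ a) → ⋁ f ≤ a
    _+_        : Carrier → Carrier → Carrier
    0#         : Carrier
    +-assoc    : ∀ a b c → (a + b) + c ≡ a + (b + c)
    +-comm     : ∀ a b → a + b ≡ b + a
    +-identityˡ : ∀ a → 0# + a ≡ a
    0-bottom   : ∀ a → 0# ≤ a
    +-⋀        : ∀ a {I : Set ℓ} (f : I → Carrier) → a + ⋀ f ≡ ⋀ (λ i → a + f i)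
    _≺_        : Carrier → Carrier → Set ℓ
    ≺-spec     : ∀ a b → (a ≺ b) ⇔
                   ((S : Carrier → Set ℓ) → ⋀ {Σ Carrier S} proj₁ ≤ a →
                      ∃ λ s → S s × s ≤ b)
    -- value distributivity: complete distributivity (approximation by ≺),
    -- 0 ≺ ⊤, and V⁺ closed under binary meets
    ≺-approx   : ∀ a → a ≡ ⋀ {Σ Carrier (λ b → a ≺ b)} proj₁
    0≺⊤        : 0# ≺ ⋀ {Lift ℓ ⊥} (λ ())
    ≺-∧        : ∀ a b → 0# ≺ a → 0# ≺ b →
                   0# ≺ ⋀ {Lift ℓ Bool} (λ { (lift t) → if t then a else b })

module VCQ {ℓ : Level} (V : ValueCoQuantale ℓ) where
  open ValueCoQuantale V public

  _∨_ : Carrier → Carrier → Carrier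
  a ∨ b = ⋁ {Lift ℓ Bool} (λ { (lift t) → if t then a else b })

  _∸_ : Carrier → Carrier → Carrier
  a ∸ b = ⋀ {Σ Carrier (λ r → a ≤ r + b)} proj₁

  dV : Carrier → Carrier → Carrier
  dV p q = (p ∸ q) ∨ (q ∸ p)

  V⁺ : Set ℓ
  V⁺ = Σ Carrier (λ ε → 0# ≺ ε)

record ContinuitySpace {ℓ : Level} (V : ValueCoQuantale ℓ) : Set (suc ℓ) where
  open ValueCoQuantale V
  field
    Pt     : Set ℓ
    d      : Pt → Pt → Carrier
    d-refl : ∀ x → d x x ≡ 0#
    d-tri  : ∀ x y z → d x y ≤ d x z + d z y

module _ {ℓ : Level} {V : ValueCoQuantale ℓ} where
  open VCQ V
  open ContinuitySpace

  _⊗_ : ContinuitySpace V → ContinuitySpace V → ContinuitySpace V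
  Pt (M ⊗ N) = Pt M × Pt N
  d (M ⊗ N) (x₁ , y₁) (x₂ , y₂) = d M x₁ x₂ ∨ d N y₁ y₂
  d-refl (M ⊗ N) (x , y) rewrite d-refl M x | d-refl N y =
    ≤-antisym (⋁-lub _ 0# (λ { (lift true) → ≤-refl ; (lift false) → ≤-refl }))
              (0-bottom _)
  d-tri (M ⊗ N) (x₁ , y₁) (x₂ , y₂) (x₃ , y₃) =
    ⋁-lub _ _ λ
      { (lift true)  → ≤-trans (d-tri M x₁ x₂ x₃) (mono (⋁-ub _ (lift true)) (⋁-ub _ (lift true)))
      ; (lift false) → ≤-trans (d-tri N y₁ y₂ y₃) (mono (⋁-ub _ (lift false)) (⋁-ub _ (lift false))) }
    where
    -- monotonicity of + follows from distributivity over binary meets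
    mono₁ : ∀ a {b c} → b ≤ c → a + b ≤ a + c
    mono₁ a {b} {c} b≤c =
      subst (λ z → a + z ≤ a + c) (sym b≡m)
        (subst (λ z → z ≤ a + c) (sym (+-⋀ a pr)) (⋀-lb _ (lift false)))
      where
      pr : Lift ℓ Bool → Carrier
      pr (lift t) = if t then b else c
      b≡m : b ≡ ⋀ pr
      b≡m = ≤-antisym (⋀-glb pr b (λ { (lift true) → ≤-refl ; (lift false) → b≤c }))
                      (⋀-lb pr (lift true))
    mono : ∀ {a a' b b'} → a ≤ a' → b ≤ b' → a + b ≤ a' + b'
    mono {a} {a'} {b} {b'} p q =
      ≤-trans (mono₁ a q)
        (subst₂ _≤_ (+-comm b' a) (+-comm b' a') (mono₁ b' p))

  IsModulus : (X : ContinuitySpace V) → (Pt X → Carrier) → (V⁺ → V⁺) → Set ℓ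
  IsModulus X g Δ = ∀ (ε : V⁺) (x y : Pt X) →
    d X x y ≤ proj₁ (Δ ε) → dV (g x) (g y) ≤ proj₁ ε

-- For fixed y, moving only the first coordinate costs d_M x x' in M × N, because
-- d_N y y = 0; so Δ is a modulus for every slice f(-, y), uniformly in y.
-- Joins and meets are nonexpansive for the sup-distance of families: if
-- g y ≤ h y + ε for all y, then ⋁ g ≤ ⋁ h + ε and, since + distributes over
-- meets, ⋀ g ≤ ⋀ h + ε.  Applying this in both directions gives the theorem.
module Submission where

open import Defs
open import Data.Product using (_×_; _,_; proj₁)
open import Data.Bool using (Bool; true; false; if_then_else_)
open import Level using (Level; Lift; lift)
open import Relation.Binary.PropositionalEquality using (_≡_; subst; subst₂; sym)

module ValueCoQuantaleProperties {ℓ : Level} (V : ValueCoQuantale ℓ) where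
  open VCQ V

  +-monoʳ-≤ : ∀ a {b c} → b ≤ c → a + b ≤ a + c
  +-monoʳ-≤ a {b} {c} b≤c =
    subst (λ z → a + z ≤ a + c) (sym b≡b∧c)
      (subst (_≤ a + c) (sym (+-⋀ a pair)) (⋀-lb _ (lift false)))
    where
    pair : Lift ℓ Bool → Carrier
    pair (lift t) = if t then b else c
    b≡b∧c : b ≡ ⋀ pair
    b≡b∧c = ≤-antisym (⋀-glb pair b λ { (lift true) → ≤-refl ; (lift false) → b≤c })
                      (⋀-lb pair (lift true))

  +-monoˡ-≤ : ∀ a {b c} → b ≤ c → b + a ≤ c + a
  +-monoˡ-≤ a {b} {c} b≤c = subst₂ _≤_ (+-comm a b) (+-comm a c) (+-monoʳ-≤ a b≤c)

  ≤+∸ : ∀ a b → a ≤ b + (a ∸ b)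
  ≤+∸ a b = subst (a ≤_) (sym (+-⋀ b proj₁))
    (⋀-glb _ a λ { (r , a≤r+b) → subst (a ≤_) (+-comm r b) a≤r+b })

  ∸≤⇒≤+ : ∀ {a b ε} → a ∸ b ≤ ε → a ≤ b + ε
  ∸≤⇒≤+ {a} {b} a∸b≤ε = ≤-trans (≤+∸ a b) (+-monoʳ-≤ b a∸b≤ε)

  ≤+⇒∸≤ : ∀ {a b ε} → a ≤ b + ε → a ∸ b ≤ ε
  ≤+⇒∸≤ {a} {b} {ε} a≤b+ε = ⋀-lb _ (ε , subst (a ≤_) (+-comm b ε) a≤b+ε)

  x≤x∨y : ∀ a b → a ≤ a ∨ b
  x≤x∨y a b = ⋁-ub _ (lift true)

  y≤x∨y : ∀ a b → b ≤ a ∨ b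
  y≤x∨y a b = ⋁-ub _ (lift false)

  ∨-least : ∀ {a b c} → a ≤ c → b ≤ c → a ∨ b ≤ c
  ∨-least a≤c b≤c = ⋁-lub _ _ λ { (lift true) → a≤c ; (lift false) → b≤c }

  dV≤⇒≤+ : ∀ {a b ε} → dV a b ≤ ε → a ≤ b + ε
  dV≤⇒≤+ {a} {b} d≤ε = ∸≤⇒≤+ (≤-trans (x≤x∨y (a ∸ b) (b ∸ a)) d≤ε)

  dV-sym : ∀ a b → dV a b ≤ dV b a
  dV-sym a b = ∨-least (y≤x∨y (b ∸ a) (a ∸ b)) (x≤x∨y (b ∸ a) (a ∸ b))

  ≤+⇒dV≤ : ∀ {a b ε} → a ≤ b + ε → b ≤ a + ε → dV a b ≤ ε
  ≤+⇒dV≤ a≤b+ε b≤a+ε = ∨-least (≤+⇒∸≤ a≤b+ε) (≤+⇒∸≤ b≤a+ε)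

  module _ {I : Set ℓ} (g h : I → Carrier) (ε : Carrier) where

    ⋁-≤+ : (∀ i → g i ≤ h i + ε) → ⋁ g ≤ ⋁ h + ε
    ⋁-≤+ g≤h+ε = ⋁-lub g _ λ i → ≤-trans (g≤h+ε i) (+-monoˡ-≤ ε (⋁-ub h i))

    ⋀-≤+ : (∀ i → g i ≤ h i + ε) → ⋀ g ≤ ⋀ h + ε
    ⋀-≤+ g≤h+ε = subst (⋀ g ≤_) (+-comm ε (⋀ h))
      (subst (⋀ g ≤_) (sym (+-⋀ ε h))
        (⋀-glb _ _ λ i → ≤-trans (⋀-lb g i) (subst (g i ≤_) (+-comm (h i) ε) (g≤h+ε i))))

  module _ {I : Set ℓ} {g h : I → Carrier} {ε : Carrier} (close : ∀ i → dV (g i) (h i) ≤ ε) where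

    dV-⋁-≤ : dV (⋁ g) (⋁ h) ≤ ε
    dV-⋁-≤ = ≤+⇒dV≤ (⋁-≤+ g h ε λ i → dV≤⇒≤+ (close i))
                    (⋁-≤+ h g ε λ i → dV≤⇒≤+ (≤-trans (dV-sym (h i) (g i)) (close i)))

    dV-⋀-≤ : dV (⋀ g) (⋀ h) ≤ ε
    dV-⋀-≤ = ≤+⇒dV≤ (⋀-≤+ g h ε λ i → dV≤⇒≤+ (close i))
                    (⋀-≤+ h g ε λ i → dV≤⇒≤+ (≤-trans (dV-sym (h i) (g i)) (close i)))

module _ {ℓ : Level} {V : ValueCoQuantale ℓ} (M N : ContinuitySpace V) where
  open VCQ V
  open ValueCoQuantaleProperties V
  open ContinuitySpace

  d-⊗-≤-slice : ∀ {x x' y e} → d M x x' ≤ e → d (M ⊗ N) (x , y) (x' , y) ≤ e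
  d-⊗-≤-slice {y = y} dM≤e = ∨-least dM≤e (subst (_≤ _) (sym (d-refl N y)) (0-bottom _))

  IsModulus-slice : ∀ (f : Pt M × Pt N → Carrier) Δ → IsModulus (M ⊗ N) f Δ →
    ∀ ε x x' → d M x x' ≤ proj₁ (Δ ε) → ∀ y → dV (f (x , y)) (f (x' , y)) ≤ proj₁ ε
  IsModulus-slice f Δ mod ε x x' dM≤Δε y = mod ε (x , y) (x' , y) (d-⊗-≤-slice dM≤Δε)

mainTheorem10 : ∀ {ℓ} (V : ValueCoQuantale ℓ) (M N : ContinuitySpace V)
    (f : ContinuitySpace.Pt M × ContinuitySpace.Pt N → ValueCoQuantale.Carrier V)
    (Δ : VCQ.V⁺ V → VCQ.V⁺ V) →
    IsModulus (M ⊗ N) f Δ →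
    IsModulus M (λ x → ValueCoQuantale.⋁ V (λ y → f (x , y))) Δ
      × IsModulus M (λ x → ValueCoQuantale.⋀ V (λ y → f (x , y))) Δ
mainTheorem10 V M N f Δ mod =
    (λ ε x x' dM≤Δε → dV-⋁-≤ (IsModulus-slice M N f Δ mod ε x x' dM≤Δε))
  , (λ ε x x' dM≤Δε → dV-⋀-≤ (IsModulus-slice M N f Δ mod ε x x' dM≤Δε))
  where open ValueCoQuantaleProperties V
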